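{- If a nested sequent calculus $\mathsf{NL}$, sound and complete for a logic $\mathsf{L}$, has the bisimulation nested-sequent uniform interpolation property (BNUIP), then $\mathsf{L}$ has the uniform interpolation property (UIP).
   Context: $\mathsf{L}\in\{\mathsf{K},\mathsf{D},\mathsf{T}\}$, sound and complete w.r.t. $\mathsf{L}$-models (finite intransitive Kripke trees: irreflexive for $\mathsf{K}$, serial for $\mathsf{D}$, reflexive for $\mathsf{T}$). UIP: for every formula $\varphi$ and atom $p$ there are formulas $\forall p\varphi$, $\exists p\varphi$ with variables among $\mathit{Var}(\varphi)\setminus\{p\}$, $\vdash_{\mathsf{L}}\varphi\to\exists p\varphi$, $\vdash_{\mathsf{L}}\forall p\varphi\to\varphi$, and for every $\psi$ without $p$: $\vdash_{\mathsf{L}}\varphi\to\psi$ implies $\vdash_{\mathsf{L}}\exists p\varphi\to\psi$, and $\vdash_{\mathsf{L}}\psi\to\varphi$ implies $\vdash_{\mathsf{L}}\psi\to\forall p\varphi$. Nested sequents $\varphi_1,\dots,\varphi_n,[\Gamma_1],\dots,[\Gamma_m]$ have nodes labelled by finite sequences of naturals (root $1$, box $i$ inside $\sigma$ is $\sigma*i$); $\mathcal{L}(\Gamma)$ is the label set and $\sigma:\varphi\in\Gamma$ means $\varphi$ occurs at node $\sigma$. A multiworld interpretation of $\Gamma$ into $\mathcal{M}=(W,R,V)$ is $\mathcal{I}:\mathcal{L}(\Gamma)\to W$ with $\mathcal{I}(\sigma)R\,\mathcal{I}(\sigma*n)$; $\mathcal{M},\mathcal{I}\models\Gamma$ iff $\mathcal{M},\mathcal{I}(\sigma)\models\varphi$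 for some $\sigma:\varphi\in\Gamma$. Multiformulas: $\mho::=\sigma:\varphi\mid(\mho\curlywedge\mho)\mid(\mho\curlyvee\mho)$, with $\curlywedge$ multiformula conjunction and $\curlyvee$ multiformula disjunction interpreted classically and $\mathcal{M},\mathcal{I}\models\sigma:\varphi$ iff $\mathcal{M},\mathcal{I}(\sigma)\models\varphi$. $(\mathcal{M},\mathcal{I})\sim_p(\mathcal{M}',\mathcal{I}')$ means some bisimulation up to $p$ (agreement on atoms other than $p$, forth, back) relates $\mathcal{I}(\sigma)$ to $\mathcal{I}'(\sigma)$ for every label $\sigma$. $\mathsf{NL}$ has the BNUIP if for each nested sequent $\Gamma$ and atom $p$ there is a multiformula $A_p(\Gamma)$ with: (i) $\mathit{Var}(A_p(\Gamma))\subseteq\mathit{Var}(\Gamma)\setminus\{p\}$ and $\mathcal{L}(A_p(\Gamma))\subseteq\mathcal{L}(\Gamma)$; (ii) for every multiworld interpretation $\mathcal{I}$ of $\Gamma$ into an $\mathsf{L}$-model $\mathcal{M}$, $\mathcal{M},\mathcal{I}\models A_p(\Gamma)$ implies $\mathcal{M},\mathcal{I}\models\Gamma$; (iii)$'$ if $\mathcal{M},\mathcal{I}\not\models A_p(\Gamma)$ for an $\mathsf{L}$-model $\mathcal{M}$, then there are an $\mathsf{L}$-model $\mathcal{M}'$ and a multiworld interpretation $\mathcal{I}'$ of $\Gamma$ into $\mathcal{M}'$ with $(\mathcal{M}',\mathcal{I}')\sim_p(\mathcal{M},\mathcal{I})$ and $\mathcal{M}',\mathcal{I}'\not\models\Gamma$.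 -}

module Defs where

open import Data.Nat using (ℕ; zero; suc; _≤_)
open import Data.Fin using (Fin; toℕ) renaming (zero to fzero; suc to fsuc)
open import Data.Bool using (Bool; true)
open import Data.List using (List; []; _∷_; _++_; [_])
open import Data.List.Membership.Propositional using (_∈_)
open import Data.Product using (Σ; ∃; _×_; _,_)
open import Data.Sum using (_⊎_)
open import Data.Empty using (⊥)
open import Relation.Nullary using (¬_)
open import Relation.Binary.PropositionalEquality using (_≡_; _≢_)

Atom : Set
Atom = ℕ

infixr 6 _∧'_
infixr 5 _∨'_
infixr 4 _⇒_

data Form : Set where
  at   : Atom → Form
  ⊥'   : Form
  ¬'_  : Form → Form
  _∧'_ : Form → Form → Form
  _∨'_ : Form → Form → Form
  _⇒_  : Form → Form → Form
  □_   : Form → Form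
  ◇_   : Form → Form

vars : Form → List Atom
vars (at p)   = p ∷ []
vars ⊥'       = []
vars (¬' φ)   = vars φ
vars (φ ∧' ψ) = vars φ ++ vars ψ
vars (φ ∨' ψ) = vars φ ++ vars ψ
vars (φ ⇒ ψ)  = vars φ ++ vars ψ
vars (□ φ)    = vars φ
vars (◇ φ)    = vars φ

data Logic : Set where
  K D T : Logic

-- A finite rooted tree with worlds Fin (suc n), root fzero; node (fsuc i)
-- has parent (parent i), whose index is at most i.
record Tree : Set where
  field
    size      : ℕ
    parent    : Fin size → Fin (suc size)
    parent-lt : ∀ i → toℕ (parent i) ≤ toℕ i

  World : Set
  World = Fin (suc size)

  Edge : World → World → Set
  Edge x y = Σ (Fin size) λ i → (y ≡ fsuc i) × (parent i ≡ x)

-- accessibility relation of an L-tree: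
--   K : the (irreflexive, intransitive) tree relation itself
--   D : tree relation plus loops at leaves (serial)
--   T : reflexive closure of the tree relation
Acc : Logic → (t : Tree) → Tree.World t → Tree.World t → Set
Acc K t x y = Tree.Edge t x y
Acc D t x y = Tree.Edge t x y ⊎ ((x ≡ y) × (∀ z → ¬ Tree.Edge t x z))
Acc T t x y = Tree.Edge t x y ⊎ (x ≡ y)

record Model (L : Logic) : Set where
  field
    tree : Tree
    val  : Atom → Tree.World tree → Bool
  open Tree tree public
  R : World → World → Set
  R = Acc L tree

module _ {L : Logic} where
  open Model

  _,_⊨_ : (M : Model L) → World M → Form → Set
  M , w ⊨ at p    = val M p w ≡ true
  M , w ⊨ ⊥'      = ⊥
  M , w ⊨ (¬' φ)  = ¬ (M , w ⊨ φ)
  M , w ⊨ (φ ∧' ψ) = (M , w ⊨ φ) × (M , w ⊨ ψ)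
  M , w ⊨ (φ ∨' ψ) = (M , w ⊨ φ) ⊎ (M , w ⊨ ψ)
  M , w ⊨ (φ ⇒ ψ)  = (M , w ⊨ φ) → (M , w ⊨ ψ)
  M , w ⊨ (□ φ)    = ∀ v → R M w v → M , v ⊨ φ
  M , w ⊨ (◇ φ)    = Σ (World M) λ v → R M w v × (M , v ⊨ φ)

Valid : Logic → Form → Set
Valid L φ = (M : Model L) (w : Model.World M) → M , w ⊨ φ

-- Nested sequents  φ₁,…,φₙ,[Γ₁],…,[Γₘ]

data NSeq : Set where
  mk : List Form → List NSeq → NSeq

-- Nth xs n x : the n-th element of xs (1-based) is x
data Nth {A : Set} : List A → ℕ → A → Set where
  nth-here  : ∀ {x xs} → Nth (x ∷ xs) 1 x
  nth-there : ∀ {x y xs n} → Nth xs n y → Nth (x ∷ xs) (suc n) y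

Label : Set
Label = List ℕ

root : Label
root = 1 ∷ []

_*_ : Label → ℕ → Label
σ * n = σ ++ [ n ]

-- paths below a node (sequence of box indices, without the root 1)
data IsPath : List ℕ → NSeq → Set where
  p-here  : ∀ {Γ} → IsPath [] Γ
  p-there : ∀ {fs bs i π Δ} → Nth bs i Δ → IsPath π Δ → IsPath (i ∷ π) (mk fs bs)

data PathAt : List ℕ → Form → NSeq → Set where
  a-here  : ∀ {fs bs φ} → φ ∈ fs → PathAt [] φ (mk fs bs)
  a-there : ∀ {fs bs i π Δ φ} → Nth bs i Δ → PathAt π φ Δ → PathAt (i ∷ π) φ (mk fs bs)

_∈𝓛_ : Label → NSeq → Set
σ ∈𝓛 Γ = Σ (List ℕ) λ π → (σ ≡ 1 ∷ π) × IsPath π Γ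

_∶_∈ₛ_ : Label → Form → NSeq → Set
σ ∶ φ ∈ₛ Γ = Σ (List ℕ) λ π → (σ ≡ 1 ∷ π) × PathAt π φ Γ

mutual
  varsS : NSeq → List Atom
  varsS (mk fs bs) = varsL fs ++ varsB bs

  varsL : List Form → List Atom
  varsL []       = []
  varsL (φ ∷ fs) = vars φ ++ varsL fs

  varsB : List NSeq → List Atom
  varsB []       = []
  varsB (Γ ∷ bs) = varsS Γ ++ varsB bs

-- 𝓘 : 𝓛(Γ) → W (given as a total function on labels; only its values on
-- 𝓛(Γ) matter) with 𝓘(σ) R 𝓘(σ*n) whenever σ, σ*n ∈ 𝓛(Γ)
IsInterp : {L : Logic} → (M : Model L) → NSeq → (Label → Model.World M) → Set
IsInterp M Γ 𝓘 = ∀ σ n → σ ∈𝓛 Γ → (σ * n) ∈𝓛 Γ → Model.R M (𝓘 σ) (𝓘 (σ * n))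

_,_⊨ₛ_ : {L : Logic} → (M : Model L) → (Label → Model.World M) → NSeq → Set
M , 𝓘 ⊨ₛ Γ = Σ Label λ σ → Σ Form λ φ → (σ ∶ φ ∈ₛ Γ) × (M , 𝓘 σ ⊨ φ)

infixr 6 _⋏_
infixr 5 _⋎_

data MF : Set where
  _∶_ : Label → Form → MF
  _⋏_ : MF → MF → MF
  _⋎_ : MF → MF → MF

varsMF : MF → List Atom
varsMF (σ ∶ φ) = vars φ
varsMF (A ⋏ B) = varsMF A ++ varsMF B
varsMF (A ⋎ B) = varsMF A ++ varsMF B

lblsMF : MF → List Label
lblsMF (σ ∶ φ) = σ ∷ []
lblsMF (A ⋏ B) = lblsMF A ++ lblsMF B
lblsMF (A ⋎ B) = lblsMF A ++ lblsMF B

_,_⊨ₘ_ : {L : Logic} → (M : Model L) → (Label → Model.World M) → MF → Set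
M , 𝓘 ⊨ₘ (σ ∶ φ) = M , 𝓘 σ ⊨ φ
M , 𝓘 ⊨ₘ (A ⋏ B) = (M , 𝓘 ⊨ₘ A) × (M , 𝓘 ⊨ₘ B)
M , 𝓘 ⊨ₘ (A ⋎ B) = (M , 𝓘 ⊨ₘ A) ⊎ (M , 𝓘 ⊨ₘ B)

record IsBisimUpTo {L : Logic} (p : Atom) (M M' : Model L)
    (Z : Model.World M → Model.World M' → Set) : Set where
  field
    atoms : ∀ {w w'} → Z w w' → ∀ q → q ≢ p → Model.val M q w ≡ Model.val M' q w'
    forth : ∀ {w w' v} → Z w w' → Model.R M w v →
            Σ (Model.World M') λ v' → Model.R M' w' v' × Z v v'
    back  : ∀ {w w' v'} → Z w w' → Model.R M' w' v' →
            Σ (Model.World M) λ v → Model.R M w v × Z v v'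

Bisim~ : {L : Logic} → Atom → NSeq →
         (M : Model L) → (Label → Model.World M) →
         (M' : Model L) → (Label → Model.World M') → Set₁
Bisim~ p Γ M 𝓘 M' 𝓘' =
  Σ (Model.World M → Model.World M' → Set) λ Z →
    IsBisimUpTo p M M' Z × (∀ σ → σ ∈𝓛 Γ → Z (𝓘 σ) (𝓘' σ))

-- BNUIP (for the calculus of L; a semantic property)

BNUIP : Logic → Set₁
BNUIP L = ∀ (Γ : NSeq) (p : Atom) → Σ MF λ A →
    (∀ q → q ∈ varsMF A → (q ∈ varsS Γ) × (q ≢ p))
  × (∀ σ → σ ∈ lblsMF A → σ ∈𝓛 Γ)
  × (∀ (M : Model L) 𝓘 → IsInterp M Γ 𝓘 → M , 𝓘 ⊨ₘ A → M , 𝓘 ⊨ₛ Γ)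
  × (∀ (M : Model L) 𝓘 → IsInterp M Γ 𝓘 → ¬ (M , 𝓘 ⊨ₘ A) →
       Σ (Model L) λ M' → Σ (Label → Model.World M') λ 𝓘' →
         IsInterp M' Γ 𝓘' × Bisim~ p Γ M' 𝓘' M 𝓘 × ¬ (M' , 𝓘' ⊨ₛ Γ))

UIP : (Form → Set) → Set
UIP ⊢ = ∀ (φ : Form) (p : Atom) → Σ Form λ ∀pφ → Σ Form λ ∃pφ →
    (∀ q → q ∈ vars ∀pφ → (q ∈ vars φ) × (q ≢ p))
  × (∀ q → q ∈ vars ∃pφ → (q ∈ vars φ) × (q ≢ p))
  × ⊢ (φ ⇒ ∃pφ)
  × ⊢ (∀pφ ⇒ φ)
  × (∀ ψ → ¬ (p ∈ vars ψ) → ⊢ (φ ⇒ ψ) → ⊢ (∃pφ ⇒ ψ))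
  × (∀ ψ → ¬ (p ∈ vars ψ) → ⊢ (ψ ⇒ φ) → ⊢ (ψ ⇒ ∀pφ))

ValidS : Logic → NSeq → Set
ValidS L Γ = ∀ (M : Model L) 𝓘 → IsInterp M Γ 𝓘 → M , 𝓘 ⊨ₛ Γ

{-# OPTIONS --safe #-}
-- The semantic content of BNUIP for the one-node sequent φ makes a multiformula,
-- read at a single world, a uniform ∀p-interpolant of φ: property (ii) makes it
-- imply φ, and (iii)' together with invariance of p-free formulas under
-- bisimulations up to p makes it weaker than every p-free ψ that implies φ.
-- The ∃p-interpolant is the dual ¬ ∀p ¬φ; both steps are classical arguments,
-- available because satisfaction in a finite model is decidable.  Soundness and
-- completeness finally move the property from validity to derivability.
module Submission where

open import Defs
open import Data.Fin using () renaming (suc to fsuc)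
open import Data.Fin.Properties using (any?; all?) renaming (_≟_ to _≟ᶠ_)
open import Data.Bool using (true) renaming (_≟_ to _≟ᵇ_)
open import Data.List using ([]; _∷_; _++_)
open import Data.List.Properties using (++-identityʳ)
open import Data.List.Membership.Propositional using (_∈_; _∉_)
open import Data.List.Membership.Propositional.Properties using (∈-++⁺ˡ; ∈-++⁺ʳ)
open import Data.List.Relation.Unary.Any using (here)
open import Data.Product using (_×_; _,_)
open import Data.Product.Function.NonDependent.Propositional using (_×-⇔_)
open import Data.Sum.Function.Propositional using (_⊎-⇔_)
open import Data.Empty using (⊥-elim)
open import Function.Base using (_∘_)
open import Function.Bundles using (_⇔_; mk⇔; Equivalence)
open import Function.Construct.Identity using (⇔-id)
open import Function.Related.TypeIsomorphisms using (→-cong-⇔; ¬-cong-⇔)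
open import Relation.Nullary using (¬_; Dec; yes; no)
open import Relation.Nullary.Decidable.Core using (_→-dec_; _×-dec_; _⊎-dec_; ¬?)
open import Relation.Binary.PropositionalEquality using (_≡_; _≢_; refl; sym; subst; cong₂)

open Equivalence using (to; from)

Edge? : (t : Tree) → ∀ x y → Dec (Tree.Edge t x y)
Edge? t x y = any? λ i → (y ≟ᶠ fsuc i) ×-dec (Tree.parent t i ≟ᶠ x)

Acc? : ∀ L (t : Tree) x y → Dec (Acc L t x y)
Acc? K t x y = Edge? t x y
Acc? D t x y = Edge? t x y ⊎-dec ((x ≟ᶠ y) ×-dec all? λ z → ¬? (Edge? t x z))
Acc? T t x y = Edge? t x y ⊎-dec (x ≟ᶠ y)

_,_⊨?_ : ∀ {L} (M : Model L) w φ → Dec (M , w ⊨ φ)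
M , w ⊨? at p    = Model.val M p w ≟ᵇ true
M , w ⊨? ⊥'      = no λ ()
M , w ⊨? (¬' φ)  = ¬? (M , w ⊨? φ)
M , w ⊨? (φ ∧' ψ) = (M , w ⊨? φ) ×-dec (M , w ⊨? ψ)
M , w ⊨? (φ ∨' ψ) = (M , w ⊨? φ) ⊎-dec (M , w ⊨? ψ)
M , w ⊨? (φ ⇒ ψ)  = (M , w ⊨? φ) →-dec (M , w ⊨? ψ)
_,_⊨?_ {L} M w (□ φ) = all? λ v → Acc? L (Model.tree M) w v →-dec (M , v ⊨? φ)
_,_⊨?_ {L} M w (◇ φ) = any? λ v → Acc? L (Model.tree M) w v ×-dec (M , v ⊨? φ)

⊨-stable : ∀ {L} (M : Model L) w φ → ¬ ¬ (M , w ⊨ φ) → M , w ⊨ φ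
⊨-stable M w φ ¬¬⊨ with M , w ⊨? φ
... | yes ⊨ = ⊨
... | no ⊭ = ⊥-elim (¬¬⊨ ⊭)

module _ {L : Logic} {p : Atom} {M M' : Model L}
         {Z : Model.World M → Model.World M' → Set}
         (bisim : IsBisimUpTo p M M' Z) where
  open IsBisimUpTo bisim

  ⊨-bisim-invariant : ∀ χ → p ∉ vars χ → ∀ {w w'} → Z w w' →
                      (M , w ⊨ χ) ⇔ (M' , w' ⊨ χ)
  ⊨-bisim-invariant (at q) p∉ z = mk⇔ (subst (_≡ true) q-agrees) (subst (_≡ true) (sym q-agrees))
    where q-agrees = atoms z q λ { refl → p∉ (here refl) }
  ⊨-bisim-invariant ⊥' p∉ z = mk⇔ (λ ()) (λ ())
  ⊨-bisim-invariant (¬' χ) p∉ z = ¬-cong-⇔ (⊨-bisim-invariant χ p∉ z)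
  ⊨-bisim-invariant (χ ∧' ξ) p∉ z =
    ⊨-bisim-invariant χ (p∉ ∘ ∈-++⁺ˡ) z ×-⇔ ⊨-bisim-invariant ξ (p∉ ∘ ∈-++⁺ʳ (vars χ)) z
  ⊨-bisim-invariant (χ ∨' ξ) p∉ z =
    ⊨-bisim-invariant χ (p∉ ∘ ∈-++⁺ˡ) z ⊎-⇔ ⊨-bisim-invariant ξ (p∉ ∘ ∈-++⁺ʳ (vars χ)) z
  ⊨-bisim-invariant (χ ⇒ ξ) p∉ z =
    →-cong-⇔ (⊨-bisim-invariant χ (p∉ ∘ ∈-++⁺ˡ) z) (⊨-bisim-invariant ξ (p∉ ∘ ∈-++⁺ʳ (vars χ)) z)
  ⊨-bisim-invariant (□ χ) p∉ z = mk⇔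
    (λ □χ v' r' → let v , r , z' = back z r' in to (⊨-bisim-invariant χ p∉ z') (□χ v r))
    (λ □χ v r → let v' , r' , z' = forth z r in from (⊨-bisim-invariant χ p∉ z') (□χ v' r'))
  ⊨-bisim-invariant (◇ χ) p∉ z = mk⇔
    (λ (v , r , ⊨χ) → let v' , r' , z' = forth z r in v' , r' , to (⊨-bisim-invariant χ p∉ z') ⊨χ)
    (λ (v' , r' , ⊨χ) → let v , r , z' = back z r' in v , r , from (⊨-bisim-invariant χ p∉ z') ⊨χ)

flatten : MF → Form
flatten (σ ∶ φ) = φ
flatten (A ⋏ B) = flatten A ∧' flatten B
flatten (A ⋎ B) = flatten A ∨' flatten B

varsMF-flatten : ∀ A → vars (flatten A) ≡ varsMF A
varsMF-flatten (σ ∶ φ) = refl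
varsMF-flatten (A ⋏ B) = cong₂ _++_ (varsMF-flatten A) (varsMF-flatten B)
varsMF-flatten (A ⋎ B) = cong₂ _++_ (varsMF-flatten A) (varsMF-flatten B)

⊨ₘ-const⇔⊨-flatten : ∀ {L} (M : Model L) w A → (M , (λ _ → w) ⊨ₘ A) ⇔ (M , w ⊨ flatten A)
⊨ₘ-const⇔⊨-flatten M w (σ ∶ φ) = ⇔-id _
⊨ₘ-const⇔⊨-flatten M w (A ⋏ B) = ⊨ₘ-const⇔⊨-flatten M w A ×-⇔ ⊨ₘ-const⇔⊨-flatten M w B
⊨ₘ-const⇔⊨-flatten M w (A ⋎ B) = ⊨ₘ-const⇔⊨-flatten M w A ⊎-⇔ ⊨ₘ-const⇔⊨-flatten M w B

⟨_⟩ : Form → NSeq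
⟨ φ ⟩ = mk (φ ∷ []) []

varsS-⟨⟩ : ∀ φ → varsS ⟨ φ ⟩ ≡ vars φ
varsS-⟨⟩ φ rewrite ++-identityʳ (vars φ ++ []) = ++-identityʳ (vars φ)

root∈𝓛⟨⟩ : ∀ φ → root ∈𝓛 ⟨ φ ⟩
root∈𝓛⟨⟩ φ = [] , refl , p-here

boxless-isInterp : ∀ {L} (M : Model L) 𝓘 fs → IsInterp M (mk fs []) 𝓘
boxless-isInterp M 𝓘 fs σ n (_ , refl , p-here) (_ , () , p-here)
boxless-isInterp M 𝓘 fs σ n (_ , refl , p-here) (_ , refl , p-there () _)

⊨ₛ⟨⟩⇔⊨-root : ∀ {L} (M : Model L) 𝓘 φ → (M , 𝓘 ⊨ₛ ⟨ φ ⟩) ⇔ (M , 𝓘 root ⊨ φ)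
⊨ₛ⟨⟩⇔⊨-root M 𝓘 φ = mk⇔ root-formula (λ ⊨φ → root , φ , ([] , refl , a-here (here refl)) , ⊨φ)
  where
    root-formula : M , 𝓘 ⊨ₛ ⟨ φ ⟩ → M , 𝓘 root ⊨ φ
    root-formula (_ , _ , (_ , refl , a-here (here refl)) , ⊨φ) = ⊨φ

record UniformForall (L : Logic) (φ : Form) (p : Atom) : Set where
  field
    ∀pφ      : Form
    vars-⊆   : ∀ q → q ∈ vars ∀pφ → (q ∈ vars φ) × (q ≢ p)
    entails  : Valid L (∀pφ ⇒ φ)
    greatest : ∀ ψ → p ∉ vars ψ → Valid L (ψ ⇒ φ) → Valid L (ψ ⇒ ∀pφ)

BNUIP⇒uniformForall : ∀ {L} → BNUIP L → ∀ φ p → UniformForall L φ p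
BNUIP⇒uniformForall bnuip φ p with bnuip ⟨ φ ⟩ p
... | A , vars-A , _ , A⊨Γ , A-complete = record
  { ∀pφ      = flatten A
  ; vars-⊆   = vars-⊆
  ; entails  = entails
  ; greatest = greatest
  }
  where
    vars-⊆ : ∀ q → q ∈ vars (flatten A) → (q ∈ vars φ) × (q ≢ p)
    vars-⊆ q q∈A with vars-A q (subst (q ∈_) (varsMF-flatten A) q∈A)
    ... | q∈Γ , q≢p = subst (q ∈_) (varsS-⟨⟩ φ) q∈Γ , q≢p

    entails : Valid _ (flatten A ⇒ φ)
    entails M w ⊨A = to (⊨ₛ⟨⟩⇔⊨-root M _ φ)
      (A⊨Γ M (λ _ → w) (boxless-isInterp M _ _) (from (⊨ₘ-const⇔⊨-flatten M w A) ⊨A))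

    -- A world refuting A is p-bisimilar to the root of a countermodel to φ,
    -- where ψ, being p-free, still holds and so forces φ.
    greatest : ∀ ψ → p ∉ vars ψ → Valid _ (ψ ⇒ φ) → Valid _ (ψ ⇒ flatten A)
    greatest ψ p∉ψ ψ⇒φ M w ⊨ψ = ⊨-stable M w (flatten A) λ ⊭A →
      let M' , 𝓘' , _ , (_ , bisim , related) , ⊭Γ =
            A-complete M (λ _ → w) (boxless-isInterp M _ _) (⊭A ∘ to (⊨ₘ-const⇔⊨-flatten M w A))
          ⊨ψ' = from (⊨-bisim-invariant bisim ψ p∉ψ (related root (root∈𝓛⟨⟩ φ))) ⊨ψ
      in ⊭Γ (from (⊨ₛ⟨⟩⇔⊨-root M' 𝓘' φ) (ψ⇒φ M' (𝓘' root) ⊨ψ'))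

BNUIP⇒UIP-Valid : ∀ {L} → BNUIP L → UIP (Valid L)
BNUIP⇒UIP-Valid {L} bnuip φ p =
  ∀pφ , ¬' ∀p¬φ , vars-⊆ , ¬φ.vars-⊆ , φ⇒∃pφ , entails , ∃pφ-least , greatest
  where
    open UniformForall (BNUIP⇒uniformForall bnuip φ p)
    module ¬φ = UniformForall (BNUIP⇒uniformForall bnuip (¬' φ) p)
    ∀p¬φ = ¬φ.∀pφ

    φ⇒∃pφ : Valid L (φ ⇒ ¬' ∀p¬φ)
    φ⇒∃pφ M w ⊨φ ⊨∀p¬φ = ¬φ.entails M w ⊨∀p¬φ ⊨φ

    ∃pφ-least : ∀ ψ → p ∉ vars ψ → Valid L (φ ⇒ ψ) → Valid L (¬' ∀p¬φ ⇒ ψ)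
    ∃pφ-least ψ p∉ψ φ⇒ψ M w ⊭∀p¬φ = ⊨-stable M w ψ λ ⊭ψ →
      ⊭∀p¬φ (¬φ.greatest (¬' ψ) p∉ψ (λ M' w' ⊭ψ' ⊨φ → ⊭ψ' (φ⇒ψ M' w' ⊨φ)) M w ⊭ψ)

UIP-transfer : ∀ {⊢ ⊢′ : Form → Set} → (∀ φ → ⊢ φ → ⊢′ φ) → (∀ φ → ⊢′ φ → ⊢ φ) →
               UIP ⊢ → UIP ⊢′
UIP-transfer ⊢⇒⊢′ ⊢′⇒⊢ uip φ p with uip φ p
... | ∀pφ , ∃pφ , vars-∀ , vars-∃ , φ⇒∃ , ∀⇒φ , ∃-least , ∀-greatest =
  ∀pφ , ∃pφ , vars-∀ , vars-∃ , ⊢⇒⊢′ _ φ⇒∃ , ⊢⇒⊢′ _ ∀⇒φ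
  , (λ ψ p∉ψ φ⇒ψ → ⊢⇒⊢′ _ (∃-least ψ p∉ψ (⊢′⇒⊢ _ φ⇒ψ)))
  , (λ ψ p∉ψ ψ⇒φ → ⊢⇒⊢′ _ (∀-greatest ψ p∉ψ (⊢′⇒⊢ _ ψ⇒φ)))

-- BNUIP is a semantic property of L here.
corollary1 : (L : Logic)
    → (⊢L : Form → Set)
    → (∀ φ → ⊢L φ → Valid L φ)
    → (∀ φ → Valid L φ → ⊢L φ)
    → (NL : NSeq → Set)
    → (∀ Γ → NL Γ → ValidS L Γ)
    → (∀ Γ → ValidS L Γ → NL Γ)
    → BNUIP L
    → UIP ⊢L
corollary1 L ⊢L sound complete _ _ _ bnuip =
  UIP-transfer complete sound (BNUIP⇒UIP-Valid bnuip)
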